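{- Let $\mathbb{K}$ be a finite field and $u\in\mathbb{K}^*$ with $u\notin\{1_{\mathbb{K}},-1_{\mathbb{K}}\}$. The $u$-trinomial minimal solution of $(E_{\mathbb{K}})$ is irreducible if and only if $u$ is a root of neither $X^{2l}+X^{l+1}-1_{\mathbb{K}}$ nor $X^{2l}-X^{l+1}-1_{\mathbb{K}}$ for any integer $l\geq 1$.
   Context: For a commutative unital ring $A$ and $a_1,\ldots,a_n\in A$ set $M_n(a_1,\ldots,a_n)=\begin{pmatrix} a_n & -1_A\\ 1_A & 0_A\end{pmatrix}\cdots\begin{pmatrix} a_1 & -1_A\\ 1_A & 0_A\end{pmatrix}$. An $n$-tuple is a solution of $(E_A)$ if $M_n(a_1,\ldots,a_n)=\pm \mathrm{Id}$. For tuples, $(a_1,\ldots,a_n)\oplus(b_1,\ldots,b_m)=(a_1+b_m,a_2,\ldots,a_{n-1},a_n+b_1,b_2,\ldots,b_{m-1})$. Write $(a_1,\ldots,a_n)\sim(b_1,\ldots,b_n)$ if $(b_1,\ldots,b_n)$ is obtained from $(a_1,\ldots,a_n)$ or from $(a_n,\ldots,a_1)$ by a cyclic permutation. A solution $(c_1,\ldots,c_n)$ with $n\geq 3$ is reducible if there exist a solution $(b_1,\ldots,b_l)$ and a tuple $(a_1,\ldots,a_m)$ with $l,m\geq 3$ and $(c_1,\ldots,c_n)\sim(a_1,\ldots,a_m)\oplus(b_1,\ldots,b_l)$; otherwise irreducible. For $A$ finite and $u$ a unit of $A$, the $u$-trinomial minimal solution of $(E_A)$ is the solution of the form $(u,u^{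 -1},u^{ -1},\ldots,u,u^{ -1},u^{ -1})$ (block $(u,u^{ -1},u^{ -1})$ repeated $k\geq1$ times) of minimal size; it exists. -}

module Defs where

open import Level using (Level; _⊔_)
open import Algebra.Bundles using (CommutativeRing; Semiring)
open import Data.Nat using (ℕ; zero; suc; _≤_; _<_)
open import Data.Fin using (Fin)
open import Data.List using (List; []; _∷_; _++_; length; reverse; drop; take; concat; replicate)
open import Data.List.Relation.Binary.Pointwise using (Pointwise)
open import Data.Product using (Σ; ∃; _×_; _,_)
open import Data.Sum using (_⊎_)
open import Relation.Nullary using (¬_)
open import Relation.Binary.PropositionalEquality using (_≡_)
import Algebra.Definitions.RawSemiring as RawSemiringDefs

module Over {c ℓ : Level} (R : CommutativeRing c ℓ) where
  open CommutativeRing R public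
  open RawSemiringDefs (Semiring.rawSemiring semiring) public using (_^_)

  IsFinite : Set (c ⊔ ℓ)
  IsFinite = Σ ℕ λ n → Σ (Fin n → Carrier) λ f →
    (∀ i j → f i ≈ f j → i ≡ j) × (∀ x → ∃ λ i → f i ≈ x)

  IsField : Set (c ⊔ ℓ)
  IsField = (¬ (0# ≈ 1#)) × (∀ x → ¬ (x ≈ 0#) → ∃ λ y → x * y ≈ 1#)

  IsFiniteField : Set (c ⊔ ℓ)
  IsFiniteField = IsField × IsFinite

  record Mat : Set c where
    constructor mat
    field
      m11 m12 m21 m22 : Carrier

  _·_ : Mat → Mat → Mat
  mat a b c' d · mat e f g h =
    mat (a * e + b * g) (a * f + b * h) (c' * e + d * g) (c' * f + d * h)

  _≈M_ : Mat → Mat → Set ℓ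
  mat a b c' d ≈M mat e f g h = (a ≈ e) × (b ≈ f) × (c' ≈ g) × (d ≈ h)

  Id : Mat
  Id = mat 1# 0# 0# 1#

  -Id : Mat
  -Id = mat (- 1#) 0# 0# (- 1#)

  S : Carrier → Mat
  S a = mat a (- 1#) 1# 0#

  -- M (a₁ ∷ … ∷ aₙ) = S aₙ · … · S a₁
  M : List Carrier → Mat
  M []       = Id
  M (a ∷ as) = M as · S a

  IsSolution : List Carrier → Set ℓ
  IsSolution as = (M as ≈M Id) ⊎ (M as ≈M -Id)

  lastNE : Carrier → List Carrier → Carrier
  lastNE x []       = x
  lastNE x (y ∷ ys) = lastNE y ys

  initNE : Carrier → List Carrier → List Carrier
  initNE x []       = []
  initNE x (y ∷ ys) = x ∷ initNE y ys

  -- (a₁,…,aₙ) ⊕ (b₁,…,bₘ) = (a₁+bₘ, a₂,…,aₙ₋₁, aₙ+b₁, b₂,…,bₘ₋₁)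
  -- (only used for n, m ≥ 3; defined as [] on lists of length < 2)
  _⊕_ : List Carrier → List Carrier → List Carrier
  (a₁ ∷ a₂ ∷ as) ⊕ (b₁ ∷ b₂ ∷ bs) =
    (a₁ + lastNE b₂ bs) ∷ (initNE a₂ as ++ ((lastNE a₂ as + b₁) ∷ initNE b₂ bs))
  _ ⊕ _ = []

  _≋_ : List Carrier → List Carrier → Set (c ⊔ ℓ)
  _≋_ = Pointwise _≈_

  rotate : ℕ → List Carrier → List Carrier
  rotate k xs = drop k xs ++ take k xs

  _∼_ : List Carrier → List Carrier → Set (c ⊔ ℓ)
  as ∼ bs = ∃ λ k → (k < length as) ×
    ((bs ≋ rotate k as) ⊎ (bs ≋ rotate k (reverse as)))

  Reducible : List Carrier → Set (c ⊔ ℓ)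
  Reducible cs = ∃ λ as → ∃ λ bs →
    (3 ≤ length as) × (3 ≤ length bs) × IsSolution bs × (cs ∼ (as ⊕ bs))

  Irreducible : List Carrier → Set (c ⊔ ℓ)
  Irreducible cs = IsSolution cs × (3 ≤ length cs) × ¬ Reducible cs

  trinomial : Carrier → Carrier → ℕ → List Carrier
  trinomial u v k = concat (replicate k (u ∷ v ∷ v ∷ []))

  IsMinimalTrinomial : Carrier → Carrier → ℕ → Set ℓ
  IsMinimalTrinomial u v k = (1 ≤ k) × IsSolution (trinomial u v k) ×
    (∀ k' → 1 ≤ k' → k' < k → ¬ IsSolution (trinomial u v k'))

{-# OPTIONS --safe #-}

-- Put x = -u and y = -v = x⁻¹. Each block (u, v, v) contributes the upper triangular matrix
-- with diagonal (x, y), so the trinomial tuple of length 3q is a solution iff x^q = ±1; in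
-- particular u^k = ±1. If the trinomial solution is ∼ a ⊕ b with b a solution, the interior w
-- of b (b without its two ends) has M(w)₁₁ = ±1, because M(b) = S(bₘ) M(w) S(b₁) has corner
-- -M(w)₁₁; conversely, as det M(w) = 1, a tuple w with M(w)₁₁ = ±1 extends to a solution
-- b₁ w bₘ, which splits the trinomial solution off. The interiors are suffixes of the three
-- rotations of (u, v, v)^k, whose corners are ±x^j or ±y^j with 1 ≤ j < k (excluded by
-- minimality), 0, or y^(q+2) - x^q; and y^(q+2) - x^q = ±1 means precisely that u
-- is a root of X^(2l) ± X^(l+1) - 1 with l = q + 1. As u^k = ±1 any such root can be moved to
-- some l < k, and l = 0 is impossible.
module Submission where

open import Defs
open import Level using (Level)
open import Algebra.Bundles using (CommutativeRing)
import Algebra.Solver.Ring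
import Algebra.Solver.Ring.AlmostCommutativeRing as ACR
open import Data.Empty using (⊥-elim)
open import Data.Integer as ℤ using (ℤ; +_; -[1+_]; _⊖_; _◃_; sign; ∣_∣)
import Data.Integer.Properties as ℤ
open import Data.List using (List; []; _∷_; _++_; _∷ʳ_; length; reverse; drop; take; concat; replicate)
open import Data.List.Properties using (++-identityʳ; ++-assoc; reverse-++)
import Data.List.Relation.Binary.Pointwise as Pointwise
open import Data.List.Relation.Binary.Pointwise using (Pointwise; []; _∷_)
open import Data.Maybe using (Maybe; just; nothing)
open import Data.Nat as ℕ using (ℕ; zero; suc; _≤_; _<_; z≤n; s≤s) renaming (_*_ to _*ℕ_; _+_ to _+ℕ_)
import Data.Nat.Properties as ℕ
open import Data.Nat.DivMod using (_/_; _%_; m≡m%n+[m/n]*n; m%n<n)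
open import Data.Nat.Tactic.RingSolver using (solve-∀)
open import Data.Product using (_×_; _,_; proj₁; proj₂; ∃; ∃₂)
open import Data.Sign as Sign using (Sign)
open import Data.Sum using (_⊎_; inj₁; inj₂)
open import Function.Bundles using (_⇔_; mk⇔; Equivalence)
open import Function.Properties.Equivalence using () renaming (trans to ⇔-trans)
open import Relation.Binary.PropositionalEquality as ≡ using (_≡_; _≢_)
open import Relation.Nullary using (¬_; yes; no)

-- Algebra.Solver.Ring needs a coefficient ring mapped into R; integer coefficients are what let
-- it cancel constants such as 1 - 1 and (-1)(-1) in an arbitrary commutative ring.
module IntegerCoefficientSolver {c ℓ : Level} (R : CommutativeRing c ℓ) where
  open CommutativeRing R
  open import Algebra.Properties.Ring ring using (-0#≈0#; -‿involutive; -‿+-comm; xyx⁻¹≈y; -1*x≈-x)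
  open import Algebra.Properties.Semiring.Mult.TCOptimised semiring using (×-homo-+; ×1-homo-*) renaming (_×_ to _×′_)
  open import Algebra.Properties.CommutativeSemigroup *-commutativeSemigroup using (interchange)
  open import Relation.Binary.Reasoning.Setoid setoid

  fromSign : Sign → Carrier
  fromSign Sign.+ = 1#
  fromSign Sign.- = - 1#

  fromℤ : ℤ → Carrier
  fromℤ (+ n)    = n ×′ 1#
  fromℤ -[1+ n ] = - (suc n ×′ 1#)

  fromℤ-⊖ : ∀ m n → fromℤ (m ⊖ n) ≈ m ×′ 1# - n ×′ 1#
  fromℤ-⊖ m       zero    = sym (trans (+-congˡ -0#≈0#) (+-identityʳ _))
  fromℤ-⊖ zero    (suc n) = sym (+-identityˡ _)
  fromℤ-⊖ (suc m) (suc n) = begin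
    fromℤ (suc m ⊖ suc n)        ≡⟨ ≡.cong fromℤ (ℤ.[1+m]⊖[1+n]≡m⊖n m n) ⟩
    fromℤ (m ⊖ n)                ≈⟨ fromℤ-⊖ m n ⟩
    a - b                        ≈⟨ +-congʳ (xyx⁻¹≈y 1# a) ⟨
    (1# + a) - 1# - b            ≈⟨ +-assoc _ _ _ ⟩
    (1# + a) + (- 1# - b)        ≈⟨ +-congˡ (-‿+-comm 1# b) ⟩
    (1# + a) - (1# + b)          ≈⟨ +-cong (×-homo-+ 1# 1 m) (-‿cong (×-homo-+ 1# 1 n)) ⟨
    suc m ×′ 1# - suc n ×′ 1#    ∎
    where
    a = m ×′ 1#
    b = n ×′ 1#

  fromℤ-◃ : ∀ s n → fromℤ (s ◃ n) ≈ fromSign s * n ×′ 1#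
  fromℤ-◃ s      zero    = sym (zeroʳ _)
  fromℤ-◃ Sign.+ (suc n) = sym (*-identityˡ _)
  fromℤ-◃ Sign.- (suc n) = sym (-1*x≈-x _)

  fromSign-* : ∀ s t → fromSign (s Sign.* t) ≈ fromSign s * fromSign t
  fromSign-* Sign.+ t      = sym (*-identityˡ _)
  fromSign-* Sign.- Sign.+ = sym (*-identityʳ _)
  fromSign-* Sign.- Sign.- = sym (trans (-1*x≈-x (- 1#)) (-‿involutive 1#))

  fromℤ-+ : ∀ i j → fromℤ (i ℤ.+ j) ≈ fromℤ i + fromℤ j
  fromℤ-+ (+ m)    (+ n)    = ×-homo-+ 1# m n
  fromℤ-+ (+ m)    -[1+ n ] = fromℤ-⊖ m (suc n)
  fromℤ-+ -[1+ m ] (+ n)    = trans (fromℤ-⊖ n (suc m)) (+-comm _ _)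
  fromℤ-+ -[1+ m ] -[1+ n ] = begin
    - (suc (suc m +ℕ n) ×′ 1#)          ≡⟨ ≡.cong (λ k → - (k ×′ 1#)) (ℕ.+-suc (suc m) n) ⟨
    - ((suc m +ℕ suc n) ×′ 1#)          ≈⟨ -‿cong (×-homo-+ 1# (suc m) (suc n)) ⟩
    - (suc m ×′ 1# + suc n ×′ 1#)       ≈⟨ -‿+-comm _ _ ⟨
    - (suc m ×′ 1#) + - (suc n ×′ 1#)   ∎

  fromℤ-* : ∀ i j → fromℤ (i ℤ.* j) ≈ fromℤ i * fromℤ j
  fromℤ-* i j = begin
    fromℤ (sign i Sign.* sign j ◃ ∣ i ∣ *ℕ ∣ j ∣)
      ≈⟨ fromℤ-◃ (sign i Sign.* sign j) (∣ i ∣ *ℕ ∣ j ∣) ⟩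
    fromSign (sign i Sign.* sign j) * (∣ i ∣ *ℕ ∣ j ∣) ×′ 1#
      ≈⟨ *-cong (fromSign-* (sign i) (sign j)) (×1-homo-* ∣ i ∣ ∣ j ∣) ⟩
    (σ i * σ j) * (∣ i ∣ ×′ 1# * ∣ j ∣ ×′ 1#)
      ≈⟨ interchange _ _ _ _ ⟩
    (σ i * ∣ i ∣ ×′ 1#) * (σ j * ∣ j ∣ ×′ 1#)
      ≈⟨ *-cong (signAbs i) (signAbs j) ⟨
    fromℤ i * fromℤ j ∎
    where
    σ : ℤ → Carrier
    σ k = fromSign (sign k)
    signAbs : ∀ k → fromℤ k ≈ σ k * ∣ k ∣ ×′ 1#
    signAbs k = trans (reflexive (≡.cong fromℤ (≡.sym (ℤ.◃-inverse k)))) (fromℤ-◃ (sign k) ∣ k ∣)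

  fromℤ-neg : ∀ i → fromℤ (ℤ.- i) ≈ - fromℤ i
  fromℤ-neg (+ zero)  = sym -0#≈0#
  fromℤ-neg (+ suc n) = refl
  fromℤ-neg -[1+ n ]  = sym (-‿involutive _)

  fromℤ-homomorphism : ℤ.+-*-rawRing ACR.-Raw-AlmostCommutative⟶ ACR.fromCommutativeRing R
  fromℤ-homomorphism = record
    { ⟦_⟧    = fromℤ
    ; +-homo = fromℤ-+
    ; *-homo = fromℤ-*
    ; -‿homo = fromℤ-neg
    ; 0-homo = refl
    ; 1-homo = refl
    }

  fromℤ-≟ : ∀ i j → Maybe (fromℤ i ≈ fromℤ j)
  fromℤ-≟ i j with i ℤ.≟ j
  ... | yes ≡.refl = just refl
  ... | no _       = nothing

  open Algebra.Solver.Ring ℤ.+-*-rawRing (ACR.fromCommutativeRing R) fromℤ-homomorphism fromℤ-≟ public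

  :0 :1 : ∀ {n} → Polynomial n
  :0 = con (+ 0)
  :1 = con (+ 1)

module BlockLists {ℓ} {A : Set ℓ} where
  open ≡ using (refl; sym; trans; cong; cong₂; subst)

  blocks : A → A → A → ℕ → List A
  blocks a b c n = concat (replicate n (a ∷ b ∷ c ∷ []))

  length-blocks : ∀ a b c n → length (blocks a b c n) ≡ n *ℕ 3
  length-blocks a b c zero    = refl
  length-blocks a b c (suc n) = cong (3 +ℕ_) (length-blocks a b c n)

  blocks-+ : ∀ a b c m n → blocks a b c (m +ℕ n) ≡ blocks a b c m ++ blocks a b c n
  blocks-+ a b c zero    n = refl
  blocks-+ a b c (suc m) n = cong (λ xs → a ∷ b ∷ c ∷ xs) (blocks-+ a b c m n)

  blocks-∷ʳ : ∀ a b c n → blocks a b c n ∷ʳ a ≡ a ∷ blocks b c a n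
  blocks-∷ʳ a b c zero    = refl
  blocks-∷ʳ a b c (suc n) = cong (λ xs → a ∷ b ∷ c ∷ xs) (blocks-∷ʳ a b c n)

  reverse-blocks : ∀ a b c n → reverse (blocks a b c n) ≡ blocks c b a n
  reverse-blocks a b c zero    = refl
  reverse-blocks a b c (suc n) = begin
    reverse ((a ∷ b ∷ c ∷ []) ++ blocks a b c n)   ≡⟨ reverse-++ (a ∷ b ∷ c ∷ []) (blocks a b c n) ⟩
    reverse (blocks a b c n) ++ (c ∷ b ∷ a ∷ [])  ≡⟨ cong (_++ (c ∷ b ∷ a ∷ [])) (reverse-blocks a b c n) ⟩
    blocks c b a n ++ blocks c b a 1              ≡⟨ blocks-+ c b a n 1 ⟨
    blocks c b a (n +ℕ 1)                          ≡⟨ cong (blocks c b a) (ℕ.+-comm n 1) ⟩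
    blocks c b a (suc n)                          ∎
    where open ≡.≡-Reasoning

  drop-++ˡ : ∀ n (xs ys : List A) → n ≤ length xs → drop n (xs ++ ys) ≡ drop n xs ++ ys
  drop-++ˡ zero    xs       ys _         = refl
  drop-++ˡ (suc n) (x ∷ xs) ys (s≤s n≤) = drop-++ˡ n xs ys n≤

  take-++ˡ : ∀ n (xs ys : List A) → n ≤ length xs → take n (xs ++ ys) ≡ take n xs
  take-++ˡ zero    xs       ys _         = refl
  take-++ˡ (suc n) (x ∷ xs) ys (s≤s n≤) = cong (x ∷_) (take-++ˡ n xs ys n≤)

  rotate-suc : ∀ n x (xs : List A) → n ≤ length xs →
    drop (suc n) (x ∷ xs) ++ take (suc n) (x ∷ xs) ≡ drop n (xs ∷ʳ x) ++ take n (xs ∷ʳ x)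
  rotate-suc n x xs n≤ = begin
    drop n xs ++ x ∷ take n xs          ≡⟨ ++-assoc (drop n xs) (x ∷ []) (take n xs) ⟨
    (drop n xs ∷ʳ x) ++ take n xs        ≡⟨ cong₂ _++_ (drop-++ˡ n xs (x ∷ []) n≤)
                                                       (take-++ˡ n xs (x ∷ []) n≤) ⟨
    drop n (xs ∷ʳ x) ++ take n (xs ∷ʳ x) ∎
    where open ≡.≡-Reasoning

  data Rotated (a b c : A) (n : ℕ) : List A → Set ℓ where
    abc : Rotated a b c n (blocks a b c n)
    bca : Rotated a b c n (blocks b c a n)
    cab : Rotated a b c n (blocks c a b n)

  Rotated-shift : ∀ {a b c n xs} → Rotated b c a n xs → Rotated a b c n xs
  Rotated-shift abc = bca
  Rotated-shift bca = cab
  Rotated-shift cab = abc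

  rotate-blocks : ∀ a b c n j → j ≤ n *ℕ 3 →
    Rotated a b c n (drop j (blocks a b c n) ++ take j (blocks a b c n))
  rotate-blocks a b c n       zero    _ = subst (Rotated a b c n) (sym (++-identityʳ _)) abc
  rotate-blocks a b c (suc n) (suc j) (s≤s j≤) =
    subst (Rotated a b c (suc n)) (sym rotated)
      (Rotated-shift (rotate-blocks b c a (suc n) j (ℕ.m≤n⇒m≤1+n j≤)))
    where
    j≤length : j ≤ length (b ∷ c ∷ blocks a b c n)
    j≤length = subst (λ m → j ≤ 2 +ℕ m) (sym (length-blocks a b c n)) j≤
    rotated : drop (suc j) (blocks a b c (suc n)) ++ take (suc j) (blocks a b c (suc n))
            ≡ drop j (blocks b c a (suc n)) ++ take j (blocks b c a (suc n))
    rotated = trans (rotate-suc j a (b ∷ c ∷ blocks a b c n) j≤length)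
                    (cong (λ xs → drop j (b ∷ c ∷ xs) ++ take j (b ∷ c ∷ xs)) (blocks-∷ʳ a b c n))

  data BlockSuffix (a b c : A) (n : ℕ) : List A → Set ℓ where
    blocks-suffix : ∀ {q} → q ≤ n → BlockSuffix a b c n (blocks a b c q)
    bc-suffix     : ∀ {q} → q < n → BlockSuffix a b c n (b ∷ c ∷ blocks a b c q)
    c-suffix      : ∀ {q} → q < n → BlockSuffix a b c n (c ∷ blocks a b c q)

  BlockSuffix-suc : ∀ {a b c n xs} → BlockSuffix a b c n xs → BlockSuffix a b c (suc n) xs
  BlockSuffix-suc (blocks-suffix q≤n) = blocks-suffix (ℕ.m≤n⇒m≤1+n q≤n)
  BlockSuffix-suc (bc-suffix q<n)     = bc-suffix (ℕ.m≤n⇒m≤1+n q<n)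
  BlockSuffix-suc (c-suffix q<n)      = c-suffix (ℕ.m≤n⇒m≤1+n q<n)

  drop-blocks : ∀ a b c n m → BlockSuffix a b c n (drop m (blocks a b c n))
  drop-blocks a b c zero    zero    = blocks-suffix z≤n
  drop-blocks a b c zero    (suc m) = blocks-suffix z≤n
  drop-blocks a b c (suc n) zero                = blocks-suffix ℕ.≤-refl
  drop-blocks a b c (suc n) (suc zero)          = bc-suffix ℕ.≤-refl
  drop-blocks a b c (suc n) (suc (suc zero))    = c-suffix ℕ.≤-refl
  drop-blocks a b c (suc n) (suc (suc (suc m))) = BlockSuffix-suc (drop-blocks a b c n m)

  Pointwise-drop : ∀ {r} {R : A → A → Set r} m {xs ys} → Pointwise R xs ys → Pointwise R (drop m xs) (drop m ys)
  Pointwise-drop zero    xs∼ys        = xs∼ys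
  Pointwise-drop (suc m) []           = []
  Pointwise-drop (suc m) (_ ∷ xs∼ys) = Pointwise-drop m xs∼ys

  Pointwise-∷-≢[] : ∀ {r} {R : A → A → Set r} {x xs ys} → Pointwise R (x ∷ xs) ys → ys ≢ []
  Pointwise-∷-≢[] (_ ∷ _) ()

  drop-++-∷ : ∀ (xs : List A) y ys → drop (suc (length xs)) (xs ++ y ∷ ys) ≡ ys
  drop-++-∷ []       y ys = refl
  drop-++-∷ (x ∷ xs) y ys = drop-++-∷ xs y ys

open BlockLists

module _ {r ℓ : Level} (K : CommutativeRing r ℓ) where
  open Over K
  open Mat
  open IntegerCoefficientSolver K using (solve; _:=_; _:+_; _:*_; _:-_; :-_; :0; :1)
  open import Algebra.Properties.Ring ring using (-0#≈0#; -‿involutive; -1*x≈-x)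
  open import Algebra.Properties.Semiring.Exp semiring using (^-congˡ; ^-homo-*)
  open import Algebra.Properties.CommutativeSemiring.Exp commutativeSemiring using (^-distrib-*)
  open import Algebra.Properties.CommutativeSemigroup *-commutativeSemigroup using (interchange)
  open import Relation.Binary.Reasoning.Setoid setoid

  -- Signs and units

  IsSign : Carrier → Set ℓ
  IsSign a = a ≈ 1# ⊎ a ≈ - 1#

  IsSign-resp-≈ : ∀ {a b} → a ≈ b → IsSign a → IsSign b
  IsSign-resp-≈ a≈b (inj₁ a≈1)  = inj₁ (trans (sym a≈b) a≈1)
  IsSign-resp-≈ a≈b (inj₂ a≈-1) = inj₂ (trans (sym a≈b) a≈-1)

  IsSign-neg : ∀ {a} → IsSign a → IsSign (- a)
  IsSign-neg (inj₁ a≈1)  = inj₂ (-‿cong a≈1)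
  IsSign-neg (inj₂ a≈-1) = inj₁ (trans (-‿cong a≈-1) (-‿involutive 1#))

  IsSign-neg⁻¹ : ∀ {a} → IsSign (- a) → IsSign a
  IsSign-neg⁻¹ {a} s = IsSign-resp-≈ (-‿involutive a) (IsSign-neg s)

  IsSign-* : ∀ {a b} → IsSign a → IsSign b → IsSign (a * b)
  IsSign-* {a} {b} (inj₁ a≈1)  s = IsSign-resp-≈ (trans (sym (*-identityˡ b)) (*-congʳ (sym a≈1))) s
  IsSign-* {a} {b} (inj₂ a≈-1) s = IsSign-resp-≈ (trans (sym (-1*x≈-x b)) (*-congʳ (sym a≈-1))) (IsSign-neg s)

  IsSign⇒square≈1 : ∀ {a} → IsSign a → a * a ≈ 1#
  IsSign⇒square≈1 (inj₁ a≈1)  = trans (*-cong a≈1 a≈1) (*-identityʳ 1#)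
  IsSign⇒square≈1 (inj₂ a≈-1) = trans (*-cong a≈-1 a≈-1) (solve 0 ((:- :1) :* (:- :1) := :1) refl)

  IsSign-inverseˡ-unique : ∀ {a b} → a * b ≈ 1# → IsSign b → a ≈ b
  IsSign-inverseˡ-unique {a} {b} ab≈1 s = begin
    a             ≈⟨ *-identityʳ a ⟨
    a * 1#        ≈⟨ *-congˡ (IsSign⇒square≈1 s) ⟨
    a * (b * b)   ≈⟨ *-assoc a b b ⟨
    (a * b) * b   ≈⟨ *-congʳ ab≈1 ⟩
    1# * b        ≈⟨ *-identityˡ b ⟩
    b             ∎

  IsSign-inverse : ∀ {a b} → a * b ≈ 1# → IsSign b → IsSign a
  IsSign-inverse ab≈1 s = IsSign-resp-≈ (sym (IsSign-inverseˡ-unique ab≈1 s)) s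

  ¬IsSign-0 : ¬ (0# ≈ 1#) → ¬ IsSign 0#
  ¬IsSign-0 0≉1 (inj₁ 0≈1)  = 0≉1 0≈1
  ¬IsSign-0 0≉1 (inj₂ 0≈-1) = 0≉1 (begin
    0#        ≈⟨ -0#≈0# ⟨
    - 0#      ≈⟨ -‿cong 0≈-1 ⟩
    - (- 1#)  ≈⟨ -‿involutive 1# ⟩
    1#        ∎)

  IsSign-[-1]^ : ∀ n → IsSign ((- 1#) ^ n)
  IsSign-[-1]^ zero    = inj₁ refl
  IsSign-[-1]^ (suc n) = IsSign-* (inj₂ refl) (IsSign-[-1]^ n)

  [-a]^n≈[-1]^n*a^n : ∀ a n → (- a) ^ n ≈ (- 1#) ^ n * a ^ n
  [-a]^n≈[-1]^n*a^n a n = trans (^-congˡ n (sym (-1*x≈-x a))) (^-distrib-* (- 1#) a n)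

  a*w+e*w-1≈0⇔w′-a≈e : ∀ {w w′} → w * w′ ≈ 1# →
                       ∀ a e → (a * w + e * w - 1# ≈ 0#) ⇔ (w′ - a ≈ e)
  a*w+e*w-1≈0⇔w′-a≈e {w} {w′} ww′≈1 a e = mk⇔ to from
    where
    to : a * w + e * w - 1# ≈ 0# → w′ - a ≈ e
    to eq = begin
      w′ - a
        ≈⟨ solve 4 (λ a e w w′ → w′ :- a
             := e :- (a :* w :+ e :* w :- :1) :* w′ :+ (w :* w′ :- :1) :* (a :+ e)) refl a e w w′ ⟩
      e - (a * w + e * w - 1#) * w′ + (w * w′ - 1#) * (a + e)
        ≈⟨ +-cong (+-congˡ (-‿cong (*-congʳ eq))) (*-congʳ (+-congʳ ww′≈1)) ⟩
      e - 0# * w′ + (1# - 1#) * (a + e)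
        ≈⟨ solve 3 (λ a e w′ → e :- :0 :* w′ :+ (:1 :- :1) :* (a :+ e) := e) refl a e w′ ⟩
      e ∎
    from : w′ - a ≈ e → a * w + e * w - 1# ≈ 0#
    from eq = begin
      a * w + e * w - 1#          ≈⟨ +-congʳ (+-congˡ (*-congʳ (sym eq))) ⟩
      a * w + (w′ - a) * w - 1#
        ≈⟨ solve 3 (λ a w w′ → a :* w :+ (w′ :- a) :* w :- :1 := w :* w′ :- :1) refl a w w′ ⟩
      w * w′ - 1#                 ≈⟨ +-congʳ ww′≈1 ⟩
      1# - 1#                     ≈⟨ -‿inverseʳ 1# ⟩
      0#                          ∎

  a*b≈1⇒aⁿ*bⁿ≈1 : ∀ {a b} → a * b ≈ 1# → ∀ n → a ^ n * b ^ n ≈ 1#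
  a*b≈1⇒aⁿ*bⁿ≈1 ab≈1 zero    = *-identityˡ 1#
  a*b≈1⇒aⁿ*bⁿ≈1 {a} {b} ab≈1 (suc n) = begin
    (a * a ^ n) * (b * b ^ n)   ≈⟨ interchange a (a ^ n) b (b ^ n) ⟩
    (a * b) * (a ^ n * b ^ n)   ≈⟨ *-cong ab≈1 (a*b≈1⇒aⁿ*bⁿ≈1 ab≈1 n) ⟩
    1# * 1#                     ≈⟨ *-identityˡ 1# ⟩
    1#                          ∎

  -- 2 × 2 matrices

  ≈M-refl : ∀ {A} → A ≈M A
  ≈M-refl {mat _ _ _ _} = refl , refl , refl , refl

  ≈M-sym : ∀ {A B} → A ≈M B → B ≈M A
  ≈M-sym {mat _ _ _ _} {mat _ _ _ _} (p , q , r , s) = sym p , sym q , sym r , sym s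

  ≈M-trans : ∀ {A B C} → A ≈M B → B ≈M C → A ≈M C
  ≈M-trans {mat _ _ _ _} {mat _ _ _ _} {mat _ _ _ _} (p , q , r , s) (p′ , q′ , r′ , s′) =
    trans p p′ , trans q q′ , trans r r′ , trans s s′

  ·-cong : ∀ {A A′ B B′} → A ≈M A′ → B ≈M B′ → (A · B) ≈M (A′ · B′)
  ·-cong {mat _ _ _ _} {mat _ _ _ _} {mat _ _ _ _} {mat _ _ _ _} (p , q , r , s) (p′ , q′ , r′ , s′) =
    +-cong (*-cong p p′) (*-cong q r′) , +-cong (*-cong p q′) (*-cong q s′) ,
    +-cong (*-cong r p′) (*-cong s r′) , +-cong (*-cong r q′) (*-cong s s′)

  ·-assoc : ∀ A B C → ((A · B) · C) ≈M (A · (B · C))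
  ·-assoc (mat a b c d) (mat e f g h) (mat i j k l) =
    entry a b e f g h i k , entry a b e f g h j l , entry c d e f g h i k , entry c d e f g h j l
    where
    entry : ∀ a b e f g h i j → (a * e + b * g) * i + (a * f + b * h) * j ≈ a * (e * i + f * j) + b * (g * i + h * j)
    entry = solve 8 (λ a b e f g h i j →
      (a :* e :+ b :* g) :* i :+ (a :* f :+ b :* h) :* j := a :* (e :* i :+ f :* j) :+ b :* (g :* i :+ h :* j)) refl

  ·-identityˡ : ∀ A → (Id · A) ≈M A
  ·-identityˡ (mat a b c d) = entry a c , entry b d , entry′ a c , entry′ b d
    where
    entry : ∀ a c → 1# * a + 0# * c ≈ a
    entry = solve 2 (λ a c → :1 :* a :+ :0 :* c := a) refl
    entry′ : ∀ a c → 0# * a + 1# * c ≈ c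
    entry′ = solve 2 (λ a c → :0 :* a :+ :1 :* c := c) refl

  ·-identityʳ : ∀ A → (A · Id) ≈M A
  ·-identityʳ (mat a b c d) = entry a b , entry′ a b , entry c d , entry′ c d
    where
    entry : ∀ a b → a * 1# + b * 0# ≈ a
    entry = solve 2 (λ a b → a :* :1 :+ b :* :0 := a) refl
    entry′ : ∀ a b → a * 0# + b * 1# ≈ b
    entry′ = solve 2 (λ a b → a :* :0 :+ b :* :1 := b) refl

  det : Mat → Carrier
  det (mat a b c d) = a * d - b * c

  det-· : ∀ A B → det (A · B) ≈ det A * det B
  det-· (mat a b c d) (mat e f g h) = solve 8 (λ a b c d e f g h →
    (a :* e :+ b :* g) :* (c :* f :+ d :* h) :- (a :* f :+ b :* h) :* (c :* e :+ d :* g)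
      := (a :* d :- b :* c) :* (e :* h :- f :* g)) refl a b c d e f g h

  det-M : ∀ as → det (M as) ≈ 1#
  det-M []       = solve 0 (:1 :* :1 :- :0 :* :0 := :1) refl
  det-M (a ∷ as) = begin
    det (M as · S a)        ≈⟨ det-· (M as) (S a) ⟩
    det (M as) * det (S a)  ≈⟨ *-cong (det-M as) (solve 1 (λ a → a :* :0 :- (:- :1) :* :1 := :1) refl a) ⟩
    1# * 1#                 ≈⟨ *-identityʳ 1# ⟩
    1#                      ∎

  M-++ : ∀ xs ys → M (xs ++ ys) ≈M (M ys · M xs)
  M-++ []       ys = ≈M-sym (·-identityʳ (M ys))
  M-++ (x ∷ xs) ys = ≈M-trans (·-cong (M-++ xs ys) ≈M-refl) (·-assoc (M ys) (M xs) (S x))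

  M-∷ʳ : ∀ xs a → M (xs ∷ʳ a) ≈M (S a · M xs)
  M-∷ʳ xs a = ≈M-trans (M-++ xs (a ∷ [])) (·-cong (·-identityˡ (S a)) ≈M-refl)

  M-cong : ∀ {xs ys} → xs ≋ ys → M xs ≈M M ys
  M-cong []            = ≈M-refl
  M-cong (x≈y ∷ xs≈ys) = ·-cong (M-cong xs≈ys) (x≈y , refl , refl , refl)

  record FirstRow (A : Mat) (p q : Carrier) : Set ℓ where
    constructor firstRow
    field
      m11≈ : m11 A ≈ p
      m12≈ : m12 A ≈ q

  FirstRow-resp : ∀ {A p p′ q q′} → p ≈ p′ → q ≈ q′ → FirstRow A p q → FirstRow A p′ q′
  FirstRow-resp p≈p′ q≈q′ (firstRow m11≈p m12≈q) = firstRow (trans m11≈p p≈p′) (trans m12≈q q≈q′)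

  FirstRow-∷ : ∀ a w {p q} → FirstRow (M w) p q → FirstRow (M (a ∷ w)) (p * a + q) (- p)
  FirstRow-∷ a w (firstRow m11≈p m12≈q) = firstRow
    (+-cong (*-congʳ m11≈p) (trans (*-identityʳ _) m12≈q))
    (trans (solve 2 (λ m n → m :* (:- :1) :+ n :* :0 := :- m) refl (m11 (M w)) (m12 (M w))) (-‿cong m11≈p))

  Is±Id : Mat → Set ℓ
  Is±Id A = (A ≈M Id) ⊎ (A ≈M -Id)

  Is±Id-resp : ∀ {A B} → A ≈M B → Is±Id B → Is±Id A
  Is±Id-resp A≈B (inj₁ B≈Id)  = inj₁ (≈M-trans A≈B B≈Id)
  Is±Id-resp A≈B (inj₂ B≈-Id) = inj₂ (≈M-trans A≈B B≈-Id)

  Is±Id⇒IsSign-m11 : ∀ {A} → Is±Id A → IsSign (m11 A)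
  Is±Id⇒IsSign-m11 {mat _ _ _ _} (inj₁ (m11≈1 , _))  = inj₁ m11≈1
  Is±Id⇒IsSign-m11 {mat _ _ _ _} (inj₂ (m11≈-1 , _)) = inj₂ m11≈-1

  Is±Id⇒IsSign-m22 : ∀ {A} → Is±Id A → IsSign (m22 A)
  Is±Id⇒IsSign-m22 {mat _ _ _ _} (inj₁ (_ , _ , _ , m22≈1))  = inj₁ m22≈1
  Is±Id⇒IsSign-m22 {mat _ _ _ _} (inj₂ (_ , _ , _ , m22≈-1)) = inj₂ m22≈-1

  m22-sandwich : ∀ a P b → m22 ((S a · P) · S b) ≈ - m11 P
  m22-sandwich a (mat p q r s) b =
    solve 4 (λ p q r s → (:1 :* p :+ :0 :* r) :* (:- :1) :+ (:1 :* q :+ :0 :* s) :* :0 := :- p) refl p q r s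

  normalForm⁺ : ∀ P → det P ≈ 1# → m11 P ≈ 1# → P ≈M mat 1# (m12 P) (m21 P) (1# + m12 P * m21 P)
  normalForm⁺ (mat p q r s) det≈1 p≈1 = p≈1 , refl , refl , (begin
    s
      ≈⟨ solve 4 (λ p q r s → s := (p :* s :- q :* r) :+ (:1 :- p) :* s :+ q :* r) refl p q r s ⟩
    (p * s - q * r) + (1# - p) * s + q * r
      ≈⟨ +-congʳ (+-cong det≈1 (*-congʳ (+-congˡ (-‿cong p≈1)))) ⟩
    1# + (1# - 1#) * s + q * r
      ≈⟨ solve 3 (λ q r s → :1 :+ (:1 :- :1) :* s :+ q :* r := :1 :+ q :* r) refl q r s ⟩
    1# + q * r ∎)

  normalForm⁻ : ∀ P → det P ≈ 1# → m11 P ≈ - 1# → P ≈M mat (- 1#) (m12 P) (m21 P) (- (1# + m12 P * m21 P))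
  normalForm⁻ (mat p q r s) det≈1 p≈-1 = p≈-1 , refl , refl , (begin
    s
      ≈⟨ solve 4 (λ p q r s → s := :- (p :* s :- q :* r) :+ (:1 :+ p) :* s :- q :* r) refl p q r s ⟩
    - (p * s - q * r) + (1# + p) * s - q * r
      ≈⟨ +-congʳ (+-cong (-‿cong det≈1) (*-congʳ (+-congˡ p≈-1))) ⟩
    - 1# + (1# + - 1#) * s - q * r
      ≈⟨ solve 3 (λ q r s → :- :1 :+ (:1 :+ :- :1) :* s :- q :* r := :- (:1 :+ q :* r)) refl q r s ⟩
    - (1# + q * r) ∎)

  complete⁺ : ∀ q r → ((S r · mat 1# q r (1# + q * r)) · S (- q)) ≈M -Id
  complete⁺ q r =
    solve 2 (λ q r → (r :* :1 :+ (:- :1) :* r) :* (:- q)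
                       :+ (r :* q :+ (:- :1) :* (:1 :+ q :* r)) :* :1 := :- :1) refl q r ,
    solve 2 (λ q r → (r :* :1 :+ (:- :1) :* r) :* (:- :1)
                       :+ (r :* q :+ (:- :1) :* (:1 :+ q :* r)) :* :0 := :0) refl q r ,
    solve 2 (λ q r → (:1 :* :1 :+ :0 :* r) :* (:- q)
                       :+ (:1 :* q :+ :0 :* (:1 :+ q :* r)) :* :1 := :0) refl q r ,
    solve 2 (λ q r → (:1 :* :1 :+ :0 :* r) :* (:- :1)
                       :+ (:1 :* q :+ :0 :* (:1 :+ q :* r)) :* :0 := :- :1) refl q r

  complete⁻ : ∀ q r → ((S (- r) · mat (- 1#) q r (- (1# + q * r))) · S q) ≈M Id
  complete⁻ q r =
    solve 2 (λ q r → ((:- r) :* (:- :1) :+ (:- :1) :* r) :* q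
                       :+ ((:- r) :* q :+ (:- :1) :* (:- (:1 :+ q :* r))) :* :1 := :1) refl q r ,
    solve 2 (λ q r → ((:- r) :* (:- :1) :+ (:- :1) :* r) :* (:- :1)
                       :+ ((:- r) :* q :+ (:- :1) :* (:- (:1 :+ q :* r))) :* :0 := :0) refl q r ,
    solve 2 (λ q r → (:1 :* (:- :1) :+ :0 :* r) :* q
                       :+ (:1 :* q :+ :0 :* (:- (:1 :+ q :* r))) :* :1 := :0) refl q r ,
    solve 2 (λ q r → (:1 :* (:- :1) :+ :0 :* r) :* (:- :1)
                       :+ (:1 :* q :+ :0 :* (:- (:1 :+ q :* r))) :* :0 := :1) refl q r

  completion : ∀ P → det P ≈ 1# → IsSign (m11 P) → ∃₂ λ a b → Is±Id ((S a · P) · S b)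
  completion P det≈1 (inj₁ m11≈1) = m21 P , - m12 P ,
    inj₂ (≈M-trans (·-cong (·-cong ≈M-refl (normalForm⁺ P det≈1 m11≈1)) ≈M-refl)
                   (complete⁺ (m12 P) (m21 P)))
  completion P det≈1 (inj₂ m11≈-1) = - m21 P , m12 P ,
    inj₁ (≈M-trans (·-cong (·-cong ≈M-refl (normalForm⁻ P det≈1 m11≈-1)) ≈M-refl)
                   (complete⁻ (m12 P) (m21 P)))

  module _ {b c : Carrier} (c*b≈1 : c * b ≈ 1#) where

    FirstRow-c∷ : ∀ w {p} → FirstRow (M w) p 0# → FirstRow (M (c ∷ w)) (p * c) (- p)
    FirstRow-c∷ w row = FirstRow-resp (+-identityʳ _) refl (FirstRow-∷ c w row)

    FirstRow-bc∷ : ∀ w {p} → FirstRow (M w) p 0# → FirstRow (M (b ∷ c ∷ w)) 0# (- (p * c))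
    FirstRow-bc∷ w {p} row = FirstRow-resp pcb-p≈0 refl (FirstRow-∷ b (c ∷ w) (FirstRow-c∷ w row))
      where
      pcb-p≈0 : p * c * b + - p ≈ 0#
      pcb-p≈0 = begin
        p * c * b + - p     ≈⟨ +-congʳ (*-assoc p c b) ⟩
        p * (c * b) + - p   ≈⟨ +-congʳ (*-congˡ c*b≈1) ⟩
        p * 1# + - p        ≈⟨ +-congʳ (*-identityʳ p) ⟩
        p + - p             ≈⟨ -‿inverseʳ p ⟩
        0#                  ∎

    FirstRow-abc∷ : ∀ a w {p} → FirstRow (M w) p 0# → FirstRow (M (a ∷ b ∷ c ∷ w)) (- c * p) 0#
    FirstRow-abc∷ a w {p} row = FirstRow-resp
      (solve 3 (λ a c p → :0 :* a :+ :- (p :* c) := :- c :* p) refl a c p)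
      (solve 0 (:- :0 := :0) refl)
      (FirstRow-∷ a (b ∷ c ∷ w) (FirstRow-bc∷ w row))

    FirstRow-blocks : ∀ a q → FirstRow (M (blocks a b c q)) ((- c) ^ q) 0#
    FirstRow-blocks a zero    = firstRow refl refl
    FirstRow-blocks a (suc q) = FirstRow-abc∷ a (blocks a b c q) (FirstRow-blocks a q)

    ¬IsSign-m11-BlockSuffix : ¬ (0# ≈ 1#) → ∀ {a n} → (∀ j → 1 ≤ j → j ≤ n → ¬ IsSign ((- c) ^ j)) →
                              ∀ {w} → BlockSuffix a b c n w → w ≢ [] → ¬ IsSign (m11 (M w))
    ¬IsSign-m11-BlockSuffix 0≉1 small (blocks-suffix {zero} _) w≢[] _ = w≢[] ≡.refl
    ¬IsSign-m11-BlockSuffix 0≉1 {a} small (blocks-suffix {suc q} q≤n) _ sign =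
      small (suc q) (s≤s z≤n) q≤n (IsSign-resp-≈ (FirstRow.m11≈ (FirstRow-blocks a (suc q))) sign)
    ¬IsSign-m11-BlockSuffix 0≉1 {a} small (bc-suffix {q} _) _ sign =
      ¬IsSign-0 0≉1 (IsSign-resp-≈ (FirstRow.m11≈ (FirstRow-bc∷ (blocks a b c q) (FirstRow-blocks a q))) sign)
    ¬IsSign-m11-BlockSuffix 0≉1 {a} small (c-suffix {q} q<n) _ sign =
      small (suc q) (s≤s z≤n) q<n (IsSign-resp-≈ neg-P*c≈ (IsSign-neg (IsSign-resp-≈ m11≈P*c sign)))
      where
      P = (- c) ^ q
      m11≈P*c : m11 (M (c ∷ blocks a b c q)) ≈ P * c
      m11≈P*c = FirstRow.m11≈ (FirstRow-c∷ (blocks a b c q) (FirstRow-blocks a q))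
      neg-P*c≈ : - (P * c) ≈ (- c) ^ suc q
      neg-P*c≈ = solve 2 (λ P c → :- (P :* c) := (:- c) :* P) refl P c

  -- Sums of tuples

  initNE-∷ʳ : ∀ x xs y → initNE x (xs ∷ʳ y) ≡ x ∷ xs
  initNE-∷ʳ x []       y = ≡.refl
  initNE-∷ʳ x (z ∷ zs) y = ≡.cong (x ∷_) (initNE-∷ʳ z zs y)

  lastNE-∷ʳ : ∀ x xs y → lastNE x (xs ∷ʳ y) ≡ y
  lastNE-∷ʳ x []       y = ≡.refl
  lastNE-∷ʳ x (z ∷ zs) y = lastNE-∷ʳ z zs y

  ∷-initNE-lastNE : ∀ x xs → x ∷ xs ≡ initNE x xs ∷ʳ lastNE x xs
  ∷-initNE-lastNE x []       = ≡.refl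
  ∷-initNE-lastNE x (y ∷ ys) = ≡.cong (x ∷_) (∷-initNE-lastNE y ys)

  length-initNE : ∀ x xs → length (initNE x xs) ≡ length xs
  length-initNE x []       = ≡.refl
  length-initNE x (y ∷ ys) = ≡.cong suc (length-initNE y ys)

  ⊕-∷ʳ : ∀ a₁ a₂ as aₙ b₁ b₂ bs bₘ →
    ((a₁ ∷ a₂ ∷ as) ∷ʳ aₙ) ⊕ ((b₁ ∷ b₂ ∷ bs) ∷ʳ bₘ)
      ≡ (a₁ + bₘ) ∷ a₂ ∷ as ++ (aₙ + b₁) ∷ b₂ ∷ bs
  ⊕-∷ʳ a₁ a₂ as aₙ b₁ b₂ bs bₘ
    rewrite lastNE-∷ʳ b₂ bs bₘ | initNE-∷ʳ a₂ as aₙ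
          | lastNE-∷ʳ a₂ as aₙ | initNE-∷ʳ b₂ bs bₘ = ≡.refl

  drop-⊕ : ∀ a₁ a₂ as b₁ b₂ bs →
    drop (length (a₁ ∷ a₂ ∷ as)) ((a₁ ∷ a₂ ∷ as) ⊕ (b₁ ∷ b₂ ∷ bs)) ≡ initNE b₂ bs
  drop-⊕ a₁ a₂ as b₁ b₂ bs =
    ≡.subst (λ n → drop (suc n) (initNE a₂ as ++ (lastNE a₂ as + b₁) ∷ initNE b₂ bs) ≡ initNE b₂ bs)
      (length-initNE a₂ as) (drop-++-∷ (initNE a₂ as) (lastNE a₂ as + b₁) (initNE b₂ bs))

  m22-M-∷-∷ʳ : ∀ b₁ w bₘ → m22 (M (b₁ ∷ (w ∷ʳ bₘ))) ≈ - m11 (M w)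
  m22-M-∷-∷ʳ b₁ w bₘ = trans (proj₂ (proj₂ (proj₂ (·-cong (M-∷ʳ w bₘ) (≈M-refl {S b₁})))))
                             (m22-sandwich bₘ (M w) b₁)

  IsSolution⇒IsSign-interior : ∀ b₁ b₂ bs → IsSolution (b₁ ∷ b₂ ∷ bs) → IsSign (m11 (M (initNE b₂ bs)))
  IsSolution⇒IsSign-interior b₁ b₂ bs sol = IsSign-neg⁻¹ (IsSign-resp-≈ m22≈ (Is±Id⇒IsSign-m22 sol))
    where
    m22≈ : m22 (M (b₁ ∷ b₂ ∷ bs)) ≈ - m11 (M (initNE b₂ bs))
    m22≈ = ≡.subst (λ zs → m22 (M (b₁ ∷ zs)) ≈ - m11 (M (initNE b₂ bs))) (≡.sym (∷-initNE-lastNE b₂ bs))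
                   (m22-M-∷-∷ʳ b₁ (initNE b₂ bs) (lastNE b₂ bs))

  ≋⇒∼ : ∀ {xs ys} → 0 < length xs → ys ≋ xs → xs ∼ ys
  ≋⇒∼ {xs} 0<length ys≋xs = 0 , 0<length , inj₁ (≡.subst (_ ≋_) (≡.sym (++-identityʳ xs)) ys≋xs)

  ∼-blocks : ∀ a b n {ys} → blocks a b b n ∼ ys → ∃ λ xs → Rotated a b b n xs × ys ≋ xs
  ∼-blocks a b n {ys} (j , j<length , ys≋rotation) = rotated ys≋rotation
    where
    j≤ : j ≤ n *ℕ 3
    j≤ = ≡.subst (j ≤_) (length-blocks a b b n) (ℕ.<⇒≤ j<length)
    rotated : (ys ≋ rotate j (blocks a b b n)) ⊎ (ys ≋ rotate j (reverse (blocks a b b n))) →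
              ∃ λ xs → Rotated a b b n xs × ys ≋ xs
    rotated (inj₁ ys≋) = _ , rotate-blocks a b b n j j≤ , ys≋
    rotated (inj₂ ys≋) = _ , Rotated-shift (rotate-blocks b b a n j j≤) ,
                         ≡.subst (λ zs → ys ≋ rotate j zs) (reverse-blocks a b b n) ys≋

  module Trinomial (u v : Carrier) (u*v≈1 : u * v ≈ 1#) where

    x y : Carrier
    x = - u
    y = - v

    x*y≈1 : x * y ≈ 1#
    x*y≈1 = trans (solve 2 (λ u v → (:- u) :* (:- v) := u :* v) refl u v) u*v≈1

    x^n*y^n≈1 : ∀ n → x ^ n * y ^ n ≈ 1#
    x^n*y^n≈1 = a*b≈1⇒aⁿ*bⁿ≈1 x*y≈1

    ≈-mod-u*v≈1 : ∀ {a b} q → a ≈ b + (u * v - 1#) * q → a ≈ b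
    ≈-mod-u*v≈1 {a} {b} q a≈ = begin
      a                        ≈⟨ a≈ ⟩
      b + (u * v - 1#) * q     ≈⟨ +-congˡ (*-congʳ (+-congʳ u*v≈1)) ⟩
      b + (1# - 1#) * q        ≈⟨ solve 2 (λ b q → b :+ (:1 :- :1) :* q := b) refl b q ⟩
      b                        ∎

    M-uvv : M (u ∷ v ∷ v ∷ []) ≈M mat x (y * x - y * y) 0# y
    M-uvv = ≈M-trans (·-cong (·-cong (·-identityˡ (S v)) ≈M-refl) ≈M-refl)
      ( ≈-mod-u*v≈1 v (solve 2 (λ u v →
          (v :* v :+ (:- :1) :* :1) :* u :+ (v :* (:- :1) :+ (:- :1) :* :0) :* :1 := (:- u) :+ (u :* v :- :1) :* v) refl u v)
      , ≈-mod-u*v≈1 (- 1#) (solve 2 (λ u v →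
          (v :* v :+ (:- :1) :* :1) :* (:- :1) :+ (v :* (:- :1) :+ (:- :1) :* :0) :* :0
            := ((:- v) :* (:- u) :- (:- v) :* (:- v)) :+ (u :* v :- :1) :* (:- :1)) refl u v)
      , ≈-mod-u*v≈1 1# (solve 2 (λ u v →
          (:1 :* v :+ :0 :* :1) :* u :+ (:1 :* (:- :1) :+ :0 :* :0) :* :1 := :0 :+ (u :* v :- :1) :* :1) refl u v)
      , solve 1 (λ v → (:1 :* v :+ :0 :* :1) :* (:- :1) :+ (:1 :* (:- :1) :+ :0 :* :0) :* :0 := :- v) refl v )

    M-trinomial : ∀ q → M (trinomial u v q) ≈M mat (x ^ q) (y * x ^ q - y * y ^ q) 0# (y ^ q)
    M-trinomial zero    = refl , solve 1 (λ y → :0 := y :* :1 :- y :* :1) refl y , refl , refl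
    M-trinomial (suc q) = ≈M-trans (M-++ (u ∷ v ∷ v ∷ []) (trinomial u v q))
      (≈M-trans (·-cong (M-trinomial q) M-uvv)
        ( solve 4 (λ X Y x y → X :* x :+ (y :* X :- y :* Y) :* :0 := x :* X) refl (x ^ q) (y ^ q) x y
        , solve 4 (λ X Y x y → X :* (y :* x :- y :* y) :+ (y :* X :- y :* Y) :* y
                                 := y :* (x :* X) :- y :* (y :* Y)) refl (x ^ q) (y ^ q) x y
        , solve 2 (λ x Y → :0 :* x :+ Y :* :0 := :0) refl x (y ^ q)
        , solve 3 (λ Y x y → :0 :* (y :* x :- y :* y) :+ Y :* y := y :* Y) refl (y ^ q) x y ))

    IsSolution-trinomial⇔ : ∀ q → IsSolution (trinomial u v q) ⇔ IsSign (x ^ q)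
    IsSolution-trinomial⇔ q = mk⇔
      (λ sol → IsSign-resp-≈ (proj₁ (M-trinomial q)) (Is±Id⇒IsSign-m11 sol))
      (λ sign → Is±Id-resp (M-trinomial q) (scalar sign))
      where
      scalar : IsSign (x ^ q) → Is±Id (mat (x ^ q) (y * x ^ q - y * y ^ q) 0# (y ^ q))
      scalar sign = case sign
        where
        y^q≈x^q : y ^ q ≈ x ^ q
        y^q≈x^q = IsSign-inverseˡ-unique (trans (*-comm (y ^ q) (x ^ q)) (x^n*y^n≈1 q)) sign
        m12≈0 : y * x ^ q - y * y ^ q ≈ 0#
        m12≈0 = trans (+-congˡ (-‿cong (*-congˡ y^q≈x^q))) (-‿inverseʳ _)
        case : IsSign (x ^ q) → Is±Id (mat (x ^ q) (y * x ^ q - y * y ^ q) 0# (y ^ q))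
        case (inj₁ x^q≈1)  = inj₁ (x^q≈1 , m12≈0 , refl , trans y^q≈x^q x^q≈1)
        case (inj₂ x^q≈-1) = inj₂ (x^q≈-1 , m12≈0 , refl , trans y^q≈x^q x^q≈-1)

    FirstRow-trinomial : ∀ q → FirstRow (M (trinomial u v q)) (x ^ q) (y * x ^ q - y * y ^ q)
    FirstRow-trinomial q = firstRow (proj₁ (M-trinomial q)) (proj₁ (proj₂ (M-trinomial q)))

    m11-v∷trinomial : ∀ q → m11 (M (v ∷ trinomial u v q)) ≈ - y ^ suc q
    m11-v∷trinomial q = trans (FirstRow.m11≈ (FirstRow-∷ v (trinomial u v q) (FirstRow-trinomial q)))
      (solve 3 (λ X Y v → X :* v :+ ((:- v) :* X :- (:- v) :* Y) := :- ((:- v) :* Y)) refl (x ^ q) (y ^ q) v)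

    m11-vv∷trinomial : ∀ q → m11 (M (v ∷ v ∷ trinomial u v q)) ≈ y ^ (2 +ℕ q) - x ^ q
    m11-vv∷trinomial q =
      trans (FirstRow.m11≈ (FirstRow-∷ v (v ∷ trinomial u v q)
                             (FirstRow-∷ v (trinomial u v q) (FirstRow-trinomial q))))
        (solve 3 (λ X Y v → (X :* v :+ ((:- v) :* X :- (:- v) :* Y)) :* v :+ :- X := (:- v) :* ((:- v) :* Y) :- X)
          refl (x ^ q) (y ^ q) v)

    IsRoot : ℕ → Carrier → Set ℓ
    IsRoot l s = u ^ (2 *ℕ l) + s * u ^ (l +ℕ 1) - 1# ≈ 0#

    IsRoot-resp-sign : ∀ l {s s′} → s ≈ s′ → IsRoot l s → IsRoot l s′
    IsRoot-resp-sign l s≈s′ = trans (+-congʳ (+-congˡ (*-congʳ (sym s≈s′))))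

    IsRoot-suc⇔ : ∀ q s → IsRoot (suc q) s ⇔ (y ^ (2 +ℕ q) - x ^ q ≈ s * (- 1#) ^ q)
    IsRoot-suc⇔ q s = ⇔-trans (mk⇔ (trans (sym root≈)) (trans root≈))
                              (a*w+e*w-1≈0⇔w′-a≈e (x^n*y^n≈1 (2 +ℕ q)) (x ^ q) (s * σ))
      where
      σ = (- 1#) ^ q
      σ*σ≈1 : σ * σ ≈ 1#
      σ*σ≈1 = IsSign⇒square≈1 (IsSign-[-1]^ q)
      U = u ^ q
      W = u ^ (2 +ℕ q)
      x^q*x^[2+q]≈ : x ^ q * x ^ (2 +ℕ q) ≈ u ^ (2 *ℕ suc q)
      x^q*x^[2+q]≈ = begin
        x ^ q * x ^ (2 +ℕ q)
          ≈⟨ *-cong ([-a]^n≈[-1]^n*a^n u q) ([-a]^n≈[-1]^n*a^n u (2 +ℕ q)) ⟩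
        (σ * U) * (- 1# * (- 1# * σ) * W)
          ≈⟨ solve 3 (λ σ U W → (σ :* U) :* (:- :1 :* (:- :1 :* σ) :* W) := (σ :* σ) :* (U :* W))
                     refl σ U W ⟩
        (σ * σ) * (U * W)                      ≈⟨ *-congʳ σ*σ≈1 ⟩
        1# * (U * W)                           ≈⟨ *-identityˡ _ ⟩
        U * W                                  ≈⟨ ^-homo-* u q (2 +ℕ q) ⟨
        u ^ (q +ℕ (2 +ℕ q))                    ≡⟨ ≡.cong (u ^_) (exponent q) ⟩
        u ^ (2 *ℕ suc q)                       ∎
        where
        exponent : ∀ q → q +ℕ (2 +ℕ q) ≡ 2 *ℕ suc q
        exponent = solve-∀
      σ*x^[2+q]≈ : σ * x ^ (2 +ℕ q) ≈ u ^ (suc q +ℕ 1)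
      σ*x^[2+q]≈ = begin
        σ * x ^ (2 +ℕ q)                       ≈⟨ *-congˡ ([-a]^n≈[-1]^n*a^n u (2 +ℕ q)) ⟩
        σ * (- 1# * (- 1# * σ) * W)
          ≈⟨ solve 2 (λ σ W → σ :* (:- :1 :* (:- :1 :* σ) :* W) := (σ :* σ) :* W) refl σ W ⟩
        (σ * σ) * W                            ≈⟨ *-congʳ σ*σ≈1 ⟩
        1# * W                                 ≈⟨ *-identityˡ W ⟩
        W                                      ≡⟨ ≡.cong (λ n → u ^ suc n) (ℕ.+-comm 1 q) ⟩
        u ^ (suc q +ℕ 1)                       ∎
      root≈ : u ^ (2 *ℕ suc q) + s * u ^ (suc q +ℕ 1) - 1# ≈ x ^ q * x ^ (2 +ℕ q) + (s * σ) * x ^ (2 +ℕ q) - 1#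
      root≈ = +-congʳ (+-cong (sym x^q*x^[2+q]≈) (trans (*-congˡ (sym σ*x^[2+q]≈)) (sym (*-assoc s σ _))))

    IsRoot⇒IsSign-y^[2+q]-x^q : ∀ q {s} → IsSign s → IsRoot (suc q) s → IsSign (y ^ (2 +ℕ q) - x ^ q)
    IsRoot⇒IsSign-y^[2+q]-x^q q sign root =
      IsSign-resp-≈ (sym (Equivalence.to (IsRoot-suc⇔ q _) root)) (IsSign-* sign (IsSign-[-1]^ q))

    IsSign-y^[2+q]-x^q⇒IsRoot : ∀ q → IsSign (y ^ (2 +ℕ q) - x ^ q) → ∃ λ s → IsSign s × IsRoot (suc q) s
    IsSign-y^[2+q]-x^q⇒IsRoot q sign =
      e * σ , IsSign-* sign (IsSign-[-1]^ q) , Equivalence.from (IsRoot-suc⇔ q (e * σ)) e≈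
      where
      e = y ^ (2 +ℕ q) - x ^ q
      σ = (- 1#) ^ q
      e≈ : e ≈ (e * σ) * σ
      e≈ = begin
        e              ≈⟨ *-identityʳ e ⟨
        e * 1#         ≈⟨ *-congˡ (IsSign⇒square≈1 (IsSign-[-1]^ q)) ⟨
        e * (σ * σ)    ≈⟨ *-assoc e σ σ ⟨
        (e * σ) * σ    ∎

    ¬IsRoot-0 : ¬ (0# ≈ 1#) → ∀ {s} → IsSign s → ¬ IsRoot 0 s
    ¬IsRoot-0 0≉1 {s} sign root = 0≉1 (begin
      0#        ≈⟨ zeroˡ v ⟨
      0# * v    ≈⟨ *-congʳ u≈0 ⟨
      u * v     ≈⟨ u*v≈1 ⟩
      1#        ∎)
      where
      u≈0 : u ≈ 0#
      u≈0 = begin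
        u                           ≈⟨ *-identityˡ u ⟨
        1# * u                      ≈⟨ *-congʳ (IsSign⇒square≈1 sign) ⟨
        (s * s) * u
          ≈⟨ solve 2 (λ s u → (s :* s) :* u := s :* (:1 :+ s :* (u :* :1) :- :1)) refl s u ⟩
        s * (1# + s * (u * 1#) - 1#) ≈⟨ *-congˡ root ⟩
        s * 0#                      ≈⟨ zeroʳ s ⟩
        0#                          ∎

    IsRoot-shift : ∀ n → u ^ n * u ^ n ≈ 1# → ∀ l {s} → IsRoot (l +ℕ n) s → IsRoot l (s * u ^ n)
    IsRoot-shift n u^n*u^n≈1 l {s} root = begin
      u ^ (2 *ℕ l) + (s * u ^ n) * u ^ (l +ℕ 1) - 1#
        ≈⟨ +-congʳ (+-cong (sym even) (sym odd)) ⟩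
      u ^ (2 *ℕ (l +ℕ n)) + s * u ^ ((l +ℕ n) +ℕ 1) - 1#
        ≈⟨ root ⟩
      0# ∎
      where
      exponent₂ : ∀ l n → 2 *ℕ (l +ℕ n) ≡ 2 *ℕ l +ℕ (n +ℕ n)
      exponent₂ = solve-∀
      exponent₁ : ∀ l n → (l +ℕ n) +ℕ 1 ≡ n +ℕ (l +ℕ 1)
      exponent₁ = solve-∀
      even : u ^ (2 *ℕ (l +ℕ n)) ≈ u ^ (2 *ℕ l)
      even = begin
        u ^ (2 *ℕ (l +ℕ n))                ≡⟨ ≡.cong (u ^_) (exponent₂ l n) ⟩
        u ^ (2 *ℕ l +ℕ (n +ℕ n))           ≈⟨ ^-homo-* u (2 *ℕ l) (n +ℕ n) ⟩
        u ^ (2 *ℕ l) * u ^ (n +ℕ n)        ≈⟨ *-congˡ (trans (^-homo-* u n n) u^n*u^n≈1) ⟩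
        u ^ (2 *ℕ l) * 1#                  ≈⟨ *-identityʳ _ ⟩
        u ^ (2 *ℕ l)                       ∎
      odd : s * u ^ ((l +ℕ n) +ℕ 1) ≈ (s * u ^ n) * u ^ (l +ℕ 1)
      odd = begin
        s * u ^ ((l +ℕ n) +ℕ 1)            ≡⟨ ≡.cong (λ m → s * u ^ m) (exponent₁ l n) ⟩
        s * u ^ (n +ℕ (l +ℕ 1))            ≈⟨ *-congˡ (^-homo-* u n (l +ℕ 1)) ⟩
        s * (u ^ n * u ^ (l +ℕ 1))         ≈⟨ *-assoc s _ _ ⟨
        (s * u ^ n) * u ^ (l +ℕ 1)         ∎

    IsRoot-1#⇔ : ∀ l → IsRoot l 1# ⇔ (u ^ (2 *ℕ l) + u ^ (l +ℕ 1) - 1# ≈ 0#)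
    IsRoot-1#⇔ l = mk⇔ (trans (sym lhs≈)) (trans lhs≈)
      where lhs≈ = +-congʳ (+-congˡ (*-identityˡ (u ^ (l +ℕ 1))))

    IsRoot-[-1]⇔ : ∀ l → IsRoot l (- 1#) ⇔ (u ^ (2 *ℕ l) - u ^ (l +ℕ 1) - 1# ≈ 0#)
    IsRoot-[-1]⇔ l = mk⇔ (trans (sym lhs≈)) (trans lhs≈)
      where lhs≈ = +-congʳ (+-congˡ (-1*x≈-x (u ^ (l +ℕ 1))))

    IsSign-m11-vv∷trinomial⇒Reducible : ∀ o q → IsSign (m11 (M (v ∷ v ∷ trinomial u v q))) →
                            Reducible (trinomial u v (suc o +ℕ suc q))
    IsSign-m11-vv∷trinomial⇒Reducible o q sign =
      as , bs , s≤s (s≤s (s≤s z≤n)) , s≤s (s≤s (s≤s z≤n)) , bs-solution , ≋⇒∼ (s≤s z≤n) sum≋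
      where
      w = v ∷ v ∷ trinomial u v q
      completed = completion (M w) (det-M w) sign
      bₘ = proj₁ completed
      b₁ = proj₁ (proj₂ completed)
      as = (u - bₘ) ∷ v ∷ v ∷ trinomial u v o ∷ʳ (u - b₁)
      bs = b₁ ∷ w ∷ʳ bₘ
      bs-solution : IsSolution bs
      bs-solution = Is±Id-resp {B = (S bₘ · M w) · S b₁} (·-cong (M-∷ʳ w bₘ) (≈M-refl {S b₁}))
                      (proj₂ (proj₂ completed))
      ≋-refl : ∀ {xs} → xs ≋ xs
      ≋-refl = Pointwise.refl refl
      cancel : ∀ b → u - b + b ≈ u
      cancel b = solve 2 (λ u b → u :- b :+ b := u) refl u b
      sum≋ : (as ⊕ bs) ≋ trinomial u v (suc o +ℕ suc q)
      sum≋ = ≡.subst₂ _≋_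
        (≡.sym (⊕-∷ʳ (u - bₘ) v (v ∷ trinomial u v o) (u - b₁) b₁ v (v ∷ trinomial u v q) bₘ))
        (≡.sym (blocks-+ u v v (suc o) (suc q)))
        (cancel bₘ ∷ Pointwise.++⁺ (≋-refl {v ∷ v ∷ trinomial u v o}) (cancel b₁ ∷ ≋-refl))

  module MinimalTrinomial (0≉1 : ¬ (0# ≈ 1#)) (u v : Carrier) (u*v≈1 : u * v ≈ 1#) (k₀ : ℕ)
      (solution : IsSolution (trinomial u v (suc k₀)))
      (minimal : ∀ j → 1 ≤ j → j < suc k₀ → ¬ IsSolution (trinomial u v j)) where
    open Trinomial u v u*v≈1

    k : ℕ
    k = suc k₀

    NoRoots : Set ℓ
    NoRoots = ∀ (l : ℕ) → 1 ≤ l →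
      (¬ ((u ^ (2 *ℕ l)) + (u ^ (l +ℕ 1)) - 1# ≈ 0#)) × (¬ ((u ^ (2 *ℕ l)) - (u ^ (l +ℕ 1)) - 1# ≈ 0#))

    NoRoots⇒¬IsRoot : NoRoots → ∀ l → 1 ≤ l → ∀ {s} → IsSign s → ¬ IsRoot l s
    NoRoots⇒¬IsRoot noRoots l 1≤l (inj₁ s≈1) root =
      proj₁ (noRoots l 1≤l) (Equivalence.to (IsRoot-1#⇔ l) (IsRoot-resp-sign l s≈1 root))
    NoRoots⇒¬IsRoot noRoots l 1≤l (inj₂ s≈-1) root =
      proj₂ (noRoots l 1≤l) (Equivalence.to (IsRoot-[-1]⇔ l) (IsRoot-resp-sign l s≈-1 root))

    ¬IsSign-x^ : ∀ j → 1 ≤ j → j ≤ k₀ → ¬ IsSign (x ^ j)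
    ¬IsSign-x^ j 1≤j j≤k₀ sign = minimal j 1≤j (s≤s j≤k₀) (Equivalence.from (IsSolution-trinomial⇔ j) sign)

    ¬IsSign-y^ : ∀ j → 1 ≤ j → j ≤ k₀ → ¬ IsSign (y ^ j)
    ¬IsSign-y^ j 1≤j j≤k₀ sign = ¬IsSign-x^ j 1≤j j≤k₀ (IsSign-inverse (x^n*y^n≈1 j) sign)

    IsSign-u^k : IsSign (u ^ k)
    IsSign-u^k = IsSign-resp-≈ σ*x^k≈u^k
      (IsSign-* (IsSign-[-1]^ k) (Equivalence.to (IsSolution-trinomial⇔ k) solution))
      where
      σ = (- 1#) ^ k
      σ*x^k≈u^k : σ * x ^ k ≈ u ^ k
      σ*x^k≈u^k = begin
        σ * x ^ k            ≈⟨ *-congˡ ([-a]^n≈[-1]^n*a^n u k) ⟩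
        σ * (σ * u ^ k)      ≈⟨ *-assoc σ σ _ ⟨
        (σ * σ) * u ^ k      ≈⟨ *-congʳ (IsSign⇒square≈1 (IsSign-[-1]^ k)) ⟩
        1# * u ^ k           ≈⟨ *-identityˡ _ ⟩
        u ^ k                ∎

    IsRoot-mod : ∀ d r {s} → IsSign s → IsRoot (r +ℕ d *ℕ k) s → ∃ λ s′ → IsSign s′ × IsRoot r s′
    IsRoot-mod zero    r {s} sign root = s , sign , ≡.subst (λ n → IsRoot n s) (ℕ.+-identityʳ r) root
    IsRoot-mod (suc d) r {s} sign root =
      IsRoot-mod d r (IsSign-* sign IsSign-u^k)
        (IsRoot-shift k (IsSign⇒square≈1 IsSign-u^k) (r +ℕ d *ℕ k)
          (≡.subst (λ n → IsRoot n s) (exponent r k d) root))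
      where
      exponent : ∀ r k d → r +ℕ (k +ℕ d *ℕ k) ≡ (r +ℕ d *ℕ k) +ℕ k
      exponent = solve-∀

    IsRoot<k⇒Reducible : ∀ r → r < k → ∀ {s} → IsSign s → IsRoot r s → Reducible (trinomial u v k)
    IsRoot<k⇒Reducible zero    _          sign root = ⊥-elim (¬IsRoot-0 0≉1 sign root)
    IsRoot<k⇒Reducible (suc q) (s≤s q<k₀) sign root =
      ≡.subst (λ n → Reducible (trinomial u v n)) (≡.cong suc (≡.trans (ℕ.+-comm o (suc q)) q+o≡k₀))
        (IsSign-m11-vv∷trinomial⇒Reducible o q
          (IsSign-resp-≈ (sym (m11-vv∷trinomial q)) (IsRoot⇒IsSign-y^[2+q]-x^q q sign root)))
      where
      o = proj₁ (ℕ.m≤n⇒∃[o]m+o≡n q<k₀)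
      q+o≡k₀ = proj₂ (ℕ.m≤n⇒∃[o]m+o≡n q<k₀)

    IsRoot⇒Reducible : ∀ l {s} → IsSign s → IsRoot l s → Reducible (trinomial u v k)
    IsRoot⇒Reducible l {s} sign root =
      let s′ , sign′ , root′ = IsRoot-mod (l / k) (l % k) sign
                                 (≡.subst (λ n → IsRoot n s) (m≡m%n+[m/n]*n l k) root)
      in IsRoot<k⇒Reducible (l % k) (m%n<n l k) sign′ root′

    ¬IsSign-m11-trinomial-suffix : NoRoots → ∀ {w} → BlockSuffix u v v k₀ w → w ≢ [] → ¬ IsSign (m11 (M w))
    ¬IsSign-m11-trinomial-suffix noRoots (blocks-suffix {zero} _) w≢[] _ = w≢[] ≡.refl
    ¬IsSign-m11-trinomial-suffix noRoots (blocks-suffix {suc q} q≤k₀) _ sign =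
      ¬IsSign-x^ (suc q) (s≤s z≤n) q≤k₀ (IsSign-resp-≈ (proj₁ (M-trinomial (suc q))) sign)
    ¬IsSign-m11-trinomial-suffix noRoots (bc-suffix {q} _) _ sign =
      let s , sign-s , root = IsSign-y^[2+q]-x^q⇒IsRoot q (IsSign-resp-≈ (m11-vv∷trinomial q) sign)
      in NoRoots⇒¬IsRoot noRoots (suc q) (s≤s z≤n) sign-s root
    ¬IsSign-m11-trinomial-suffix noRoots (c-suffix {q} q<k₀) _ sign =
      ¬IsSign-y^ (suc q) (s≤s z≤n) q<k₀ (IsSign-neg⁻¹ (IsSign-resp-≈ (m11-v∷trinomial q) sign))

    ¬IsSign-interior : NoRoots → ∀ {xs} → Rotated u v v k xs →
                       ∀ m {w₀ ws} → (w₀ ∷ ws) ≋ drop (3 +ℕ m) xs → ¬ IsSign (m11 (M (w₀ ∷ ws)))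
    -- drop (3 +ℕ m) (blocks a b c (suc k₀)) reduces to drop m (blocks a b c k₀).
    ¬IsSign-interior noRoots abc m w≋ sign =
      ¬IsSign-m11-trinomial-suffix noRoots (drop-blocks u v v k₀ m)
        (Pointwise-∷-≢[] w≋) (IsSign-resp-≈ (proj₁ (M-cong w≋)) sign)
    ¬IsSign-interior noRoots bca m w≋ sign =
      ¬IsSign-m11-BlockSuffix u*v≈1 0≉1 ¬IsSign-x^ (drop-blocks v v u k₀ m)
        (Pointwise-∷-≢[] w≋) (IsSign-resp-≈ (proj₁ (M-cong w≋)) sign)
    ¬IsSign-interior noRoots cab m w≋ sign =
      ¬IsSign-m11-BlockSuffix (trans (*-comm v u) u*v≈1) 0≉1 ¬IsSign-y^ (drop-blocks v u v k₀ m)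
        (Pointwise-∷-≢[] w≋) (IsSign-resp-≈ (proj₁ (M-cong w≋)) sign)

    ¬Reducible : NoRoots → ¬ Reducible (trinomial u v k)
    ¬Reducible _ ([] , _ , () , _)
    ¬Reducible _ (_ ∷ [] , _ , s≤s () , _)
    ¬Reducible _ (_ ∷ _ ∷ [] , _ , s≤s (s≤s ()) , _)
    ¬Reducible _ (_ ∷ _ ∷ _ ∷ _ , [] , _ , () , _)
    ¬Reducible _ (_ ∷ _ ∷ _ ∷ _ , _ ∷ [] , _ , s≤s () , _)
    ¬Reducible _ (_ ∷ _ ∷ _ ∷ _ , _ ∷ _ ∷ [] , _ , s≤s (s≤s ()) , _)
    ¬Reducible noRoots (a₁ ∷ a₂ ∷ a₃ ∷ as , b₁ ∷ b₂ ∷ b₃ ∷ bs , _ , _ , bs-sol , trinomial∼sum) =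
      let xs , rotated , sum≋ = ∼-blocks u v k trinomial∼sum
      in ¬IsSign-interior noRoots rotated (length as)
           (≡.subst (_≋ drop (3 +ℕ length as) xs) (drop-⊕ a₁ a₂ (a₃ ∷ as) b₁ b₂ (b₃ ∷ bs))
             (Pointwise-drop (3 +ℕ length as) sum≋))
           (IsSolution⇒IsSign-interior b₁ b₂ (b₃ ∷ bs) bs-sol)

    irreducible⇔noRoots : Irreducible (trinomial u v k) ⇔ NoRoots
    irreducible⇔noRoots = mk⇔
      (λ (_ , _ , ¬reducible) l 1≤l →
          (λ root → ¬reducible (IsRoot⇒Reducible l (inj₁ refl) (Equivalence.from (IsRoot-1#⇔ l) root)))
        , (λ root → ¬reducible (IsRoot⇒Reducible l (inj₂ refl) (Equivalence.from (IsRoot-[-1]⇔ l) root))))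
      (λ noRoots → solution , s≤s (s≤s (s≤s z≤n)) , ¬Reducible noRoots)

lemma6p3 : {c ℓ : Level} (K : CommutativeRing c ℓ) →
    let open Over K in
    IsFiniteField →
    (u v : Carrier) → u * v ≈ 1# → ¬ (u ≈ 1#) → ¬ (u ≈ - 1#) →
    (k : ℕ) → IsMinimalTrinomial u v k →
    (Irreducible (trinomial u v k) ⇔
      (∀ (l : ℕ) → 1 ≤ l →
        (¬ ((u ^ (2 *ℕ l)) + (u ^ (l +ℕ 1)) - 1# ≈ 0#)) ×
        (¬ ((u ^ (2 *ℕ l)) - (u ^ (l +ℕ 1)) - 1# ≈ 0#))))
lemma6p3 K _               u v u*v≈1 _ _ zero     (() , _)
lemma6p3 K ((0≉1 , _) , _) u v u*v≈1 _ _ (suc k₀) (_ , solution , minimal) =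
  MinimalTrinomial.irreducible⇔noRoots K 0≉1 u v u*v≈1 k₀ solution minimal
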